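{- Let $n=p_1^{\alpha_1}p_2^{\alpha_2}\cdots p_k^{\alpha_k}$ be the prime power factorization of a composite integer $n$ (distinct primes $p_i$), with $\alpha_1\ge\alpha_2\ge\cdots\ge\alpha_k$ and $\alpha_1\ge3$ if $k=1$. Then: (i) if $n=p_1^3$, both vertices $p_1$ and $p_1^2$ of $\Upsilon_n$ have maximum degree; (ii) if $n=p_1^2p_2$, then $n/p_1=p_1p_2$ and $n/p_2=p_1^2$ are the vertices of $\Upsilon_n$ of maximum degree; (iii) if $n\notin\{p_1^3,p_1^2p_2\}$, then $n/p_1,\dots,n/p_t$ are precisely the vertices of $\Upsilon_n$ of maximum degree, where $t\in\{1,\dots,k\}$ is the largest integer with $\alpha_t=\alpha_1$.
   Context: For an integer $n>1$, a proper divisor of $n$ is an integer $d$ with $1<d<n$ and $d\mid n$. The proper divisor graph $\Upsilon_n$ is the simple graph whose vertices are the proper divisors of $n$, two distinct vertices $u,v$ being adjacent iff $n\mid uv$. -}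

module Defs where

open import Data.Nat using (ℕ; zero; suc; _*_; _^_; _<_; _<?_; _≟_)
open import Data.Nat.Divisibility using (_∣_; _∣?_)
open import Data.List using (List; filter; length; upTo)
open import Data.Product using (_×_)
open import Relation.Nullary using (¬_)
open import Relation.Nullary.Decidable using (_×-dec_; ¬?)

prodPow : (ℕ → ℕ) → (ℕ → ℕ) → ℕ → ℕ
prodPow p α zero    = 1
prodPow p α (suc k) = prodPow p α k * (p (suc k) ^ α (suc k))

IsProperDivisor : ℕ → ℕ → Set
IsProperDivisor n d = 1 < d × d < n × d ∣ n

properDivisors : ℕ → List ℕ
properDivisors n = filter (λ d → (1 <? d) ×-dec (d ∣? n)) (upTo n)

-- adjacency in Υ_n: distinct vertices u, v with n ∣ u v (used inline in `degree`)

degree : ℕ → ℕ → ℕ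
degree n d = length (filter (λ e → ¬? (d ≟ e) ×-dec (n ∣? d * e)) (properDivisors n))

IsMaxDegree : ℕ → ℕ → Set
IsMaxDegree n d = IsProperDivisor n d × (∀ e → IsProperDivisor n e → degree n e ≤ degree n d)
  where open import Data.Nat using (_≤_)

-- Write a vertex as d with d * c = n. Its neighbours are the proper divisors e ≠ d that are
-- multiples of c, so for every prime q ∣ c the degree of d is at most the number S_q of proper
-- divisors of n divisible by q, and the cofactor n/q has degree S_q or S_q - 1 according as
-- q ∤ n/q or q ∣ n/q. Dividing by q gives S_q + 1 = τ(n/q), so S_{p_i} + 1 = α_i τ(n/p_i^α_i),
-- and writing n = p_1^α_1 p_j^α_j T yields S_{p_1} = S_{p_j} + (α_1 - α_j) τ(T). Hence n/p_1 has
-- maximum degree. A vertex that is no cofactor n/p_j misses at least one, and as a rule two,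
-- multiples of q among its potential neighbours, which puts it strictly below n/p_1 unless
-- n = p^3; a cofactor n/p_j with α_j < α_1 falls short of it unless n = p^2 q.

module Submission where

open import Data.Bool using (true; false)
open import Data.List using (List; []; _∷_; filter; length; upTo; _++_)
open import Data.List.Properties using (upTo-∷ʳ; filter-++; length-++)
open import Data.List.Relation.Unary.All using (_∷_)
open import Data.Nat
open import Data.Nat.DivMod using (m*n/n≡m)
open import Data.Nat.Divisibility
open import Data.Nat.ListAction using (product)
open import Data.Nat.Primality
open import Data.Nat.Primality.Factorisation using (factorise)
open import Data.Nat.Properties
open import Data.Nat.Tactic.RingSolver using (solve-∀)
open import Data.Product using (_×_; _,_; proj₁; proj₂; ∃-syntax)
open import Data.Sum using (_⊎_; inj₁; inj₂)
open import Data.Unit using (tt)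
open import Function using (_∘_)
open import Function.Bundles using (_⇔_; mk⇔)
open import Level using (Level)
open import Relation.Binary.PropositionalEquality
open import Relation.Nullary using (¬_; yes; no; does; contradiction)
open import Relation.Nullary.Decidable using (_×-dec_; ¬?)
open import Relation.Unary using (Pred; Decidable; _∩_)
open import Relation.Unary.Properties using (_∩?_; ∁?; U?)

open import Defs

private variable
  ℓ : Level
  P Q R : Pred ℕ ℓ
  c d e m n p q : ℕ

count : Decidable P → ℕ → ℕ
count P? zero = zero
count P? (suc N) with P? N
... | yes _ = suc (count P? N)
... | no  _ = count P? N

count-mono : (P? : Decidable P) (Q? : Decidable Q) →
             ∀ N → (∀ {x} → x < N → P x → Q x) → count P? N ≤ count Q? N
count-mono P? Q? zero      P⊆Q = z≤n
count-mono P? Q? (suc N) P⊆Q with P? N | Q? N | count-mono P? Q? N (P⊆Q ∘ m<n⇒m<1+n)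
... | yes _  | yes _  | ih = s≤s ih
... | yes pN | no ¬qN | _  = contradiction (P⊆Q ≤-refl pN) ¬qN
... | no _   | yes _  | ih = m≤n⇒m≤1+n ih
... | no _   | no _   | ih = ih

count-cong : (P? : Decidable P) (Q? : Decidable Q) → ∀ N →
             (∀ {x} → x < N → P x → Q x) → (∀ {x} → x < N → Q x → P x) →
             count P? N ≡ count Q? N
count-cong P? Q? N P⊆Q Q⊆P = ≤-antisym (count-mono P? Q? N P⊆Q) (count-mono Q? P? N Q⊆P)

_-?_ : Decidable P → (y : ℕ) → Decidable (P ∩ (_≢ y))
P? -? y = P? ∩? (λ x → ¬? (x ≟ y))

count-remove : (Q? : Decidable Q) → ∀ N {y} → y < N → Q y → count Q? N ≡ suc (count (Q? -? y) N)
count-remove Q? (suc N) {y} y<1+N qy with Q? N | (Q? -? y) N | y ≟ N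
... | _      | yes (_ , N≢y) | yes refl = contradiction refl N≢y
... | yes _  | no _          | yes refl =
  cong suc (count-cong Q? (Q? -? y) N (λ x<y qx → qx , <⇒≢ x<y) (λ _ → proj₁))
... | no ¬qN | _             | yes refl = contradiction qy ¬qN
... | yes _  | yes _         | no y≢N = cong suc (count-remove Q? N (≤∧≢⇒< (s≤s⁻¹ y<1+N) y≢N) qy)
... | yes qN | no ¬q-y       | no y≢N = contradiction (qN , y≢N ∘ sym) ¬q-y
... | no ¬qN | yes (qN , _)  | no _   = contradiction qN ¬qN
... | no _   | no _          | no y≢N = count-remove Q? N (≤∧≢⇒< (s≤s⁻¹ y<1+N) y≢N) qy

count-< : (P? : Decidable P) (Q? : Decidable Q) → ∀ N {y} → y < N → Q y → ¬ P y →
          (∀ {x} → x < N → P x → Q x) → suc (count P? N) ≤ count Q? N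
count-< P? Q? N {y} y<N qy ¬py P⊆Q rewrite count-remove Q? N y<N qy =
  s≤s (count-mono P? (Q? -? y) N λ x<N px → P⊆Q x<N px , λ { refl → ¬py px })

count-pos : (Q? : Decidable Q) → ∀ N {y} → y < N → Q y → 1 ≤ count Q? N
count-pos Q? N y<N qy rewrite count-remove Q? N y<N qy = s≤s z≤n

count-≤-injection : (P? : Decidable P) (Q? : Decidable Q) → ∀ N M (f : ℕ → ℕ) →
  (∀ {x} → x < N → P x → f x < M × Q (f x)) →
  (∀ {x y} → x < N → y < N → P x → P y → f x ≡ f y → x ≡ y) →
  count P? N ≤ count Q? M
count-≤-injection P? Q? zero    M f maps inj = z≤n
count-≤-injection P? Q? (suc N) M f maps inj with P? N
... | no _ = count-≤-injection P? Q? N M f (maps ∘ m<n⇒m<1+n)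
               (λ x<N y<N → inj (m<n⇒m<1+n x<N) (m<n⇒m<1+n y<N))
... | yes pN with maps ≤-refl pN
...   | fN<M , qfN rewrite count-remove Q? M fN<M qfN =
  s≤s (count-≤-injection P? (Q? -? f N) N M f
        (λ x<N px → let (fx<M , qfx) = maps (m<n⇒m<1+n x<N) px
                    in fx<M , qfx , <⇒≢ x<N ∘ inj (m<n⇒m<1+n x<N) ≤-refl px pN)
        (λ x<N y<N → inj (m<n⇒m<1+n x<N) (m<n⇒m<1+n y<N)))

count-≤1 : (P? : Decidable P) → ∀ N c → (∀ {x} → x < N → P x → x ≡ c) → count P? N ≤ 1
count-≤1 P? N c unique = count-≤-injection P? U? N 1 (λ _ → 0) (λ _ _ → s≤s z≤n , tt)
  (λ x<N y<N px py _ → trans (unique x<N px) (sym (unique y<N py)))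

count-suc : (P? : Decidable P) → ∀ N → P N → count P? (suc N) ≡ suc (count P? N)
count-suc P? N pN with P? N
... | yes _  = refl
... | no ¬pN = contradiction pN ¬pN

count-beyond : (P? : Decidable P) → ∀ {N} M → N ≤ M → (∀ {x} → N ≤ x → ¬ P x) → count P? M ≡ count P? N
count-beyond P? {N} M N≤M none with N ≟ M
... | yes refl = refl
count-beyond P? zero z≤n none | no 0≢0 = contradiction refl 0≢0
count-beyond P? {N} (suc M) N≤1+M none | no N≢1+M with P? M
... | yes pM = contradiction pM (none (s≤s⁻¹ (≤∧≢⇒< N≤1+M N≢1+M)))
... | no _   = count-beyond P? M (s≤s⁻¹ (≤∧≢⇒< N≤1+M N≢1+M)) none

count-split : (P? : Decidable P) (R? : Decidable R) → ∀ N →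
              count P? N ≡ count (P? ∩? R?) N + count (P? ∩? ∁? R?) N
count-split P? R? zero = refl
count-split P? R? (suc N) with P? N | R? N | count-split P? R? N
... | yes _ | yes _ | ih = cong suc ih
... | yes _ | no _  | ih = trans (cong suc ih) (sym (+-suc _ _))
... | no _  | yes _ | ih = ih
... | no _  | no _  | ih = ih

length-filter-filter : (P? : Decidable P) (Q? : Decidable Q) (xs : List ℕ) →
                       length (filter Q? (filter P? xs)) ≡ length (filter (P? ∩? Q?) xs)
length-filter-filter P? Q? [] = refl
length-filter-filter P? Q? (x ∷ xs) with does (P? x)
... | false = length-filter-filter P? Q? xs
... | true with does (Q? x)
...   | true  = cong suc (length-filter-filter P? Q? xs)
...   | false = length-filter-filter P? Q? xs

length-filter-upTo : (P? : Decidable P) → ∀ N → length (filter P? (upTo N)) ≡ count P? N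
length-filter-upTo P? zero = refl
length-filter-upTo P? (suc N) = begin
  length (filter P? (upTo (suc N)))         ≡⟨ cong (length ∘ filter P?) (sym (upTo-∷ʳ N)) ⟩
  length (filter P? (upTo N ++ N ∷ []))      ≡⟨ cong length (filter-++ P? (upTo N) (N ∷ [])) ⟩
  length (filter P? (upTo N) ++ filter P? (N ∷ []))
    ≡⟨ length-++ (filter P? (upTo N)) ⟩
  length (filter P? (upTo N)) + length (filter P? (N ∷ []))
    ≡⟨ cong (_+ length (filter P? (N ∷ []))) (length-filter-upTo P? N) ⟩
  count P? N + length (filter P? (N ∷ []))  ≡⟨ last ⟩
  count P? (suc N)                          ∎
  where
  open ≡-Reasoning
  last : count P? N + length (filter P? (N ∷ [])) ≡ count P? (suc N)
  last with P? N
  ... | yes _ = +-comm (count P? N) 1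
  ... | no _  = +-identityʳ (count P? N)

count-scale : (P? : Decidable P) (Q? : Decidable Q) → ∀ c .{{_ : NonZero c}} N M →
  (∀ {g} → g < N → P g → g * c < M × Q (g * c)) →
  (∀ {f} → f < M → Q f → ∃[ g ] (f ≡ g * c × g < N × P g)) →
  count P? N ≡ count Q? M
count-scale {P = P} {Q = Q} P? Q? c ⦃ c≢0 ⦄ N M into onto = ≤-antisym
  (count-≤-injection P? Q? N M (_* c) into (λ _ _ _ _ → *-cancelʳ-≡ _ _ c))
  (count-≤-injection Q? P? M N (_/ c) back back-injective)
  where
  back : ∀ {f} → f < M → Q f → f / c < N × P (f / c)
  back f<M qf with onto f<M qf
  ... | g , refl , g<N , pg = subst (λ x → x < N × P x) (sym (m*n/n≡m g c)) (g<N , pg)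
  back-injective : ∀ {x y} → x < M → y < M → Q x → Q y → x / c ≡ y / c → x ≡ y
  back-injective x<M y<M qx qy eq with onto x<M qx | onto y<M qy
  ... | g , refl , _ | h , refl , _ = cong (_* c) (trans (sym (m*n/n≡m g c)) (trans eq (m*n/n≡m h c)))

prime⇒1< : Prime p → 1 < p
prime⇒1< {p} (prime _) = nonTrivial⇒n>1 p

prime∤1 : Prime p → ¬ p ∣ 1
prime∤1 pp p∣1 = <⇒≢ (prime⇒1< pp) (sym (∣1⇒≡1 p∣1))

prime∣prime⇒≡ : Prime p → Prime q → p ∣ q → p ≡ q
prime∣prime⇒≡ pp pq p∣q with prime⇒irreducible pq p∣q
... | inj₁ refl = contradiction (prime⇒1< pp) (<-irrefl refl)
... | inj₂ p≡q  = p≡q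

prime∣^⇒≡ : Prime p → Prime q → ∀ a → p ∣ q ^ a → p ≡ q
prime∣^⇒≡ pp pq zero    p∣1 = contradiction p∣1 (prime∤1 pp)
prime∣^⇒≡ pp pq (suc a) p∣q^1+a with euclidsLemma _ _ pp p∣q^1+a
... | inj₁ p∣q   = prime∣prime⇒≡ pp pq p∣q
... | inj₂ p∣q^a = prime∣^⇒≡ pp pq a p∣q^a

prime∤^ : Prime p → Prime q → p ≢ q → ∀ a → ¬ p ∣ q ^ a
prime∤^ pp pq p≢q a p∣q^a = p≢q (prime∣^⇒≡ pp pq a p∣q^a)

prime∣^*⇒∣ : Prime p → Prime q → p ≢ q → ∀ a {m} → p ∣ q ^ a * m → p ∣ m
prime∣^*⇒∣ pp pq p≢q a p∣q^a*m with euclidsLemma _ _ pp p∣q^a*m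
... | inj₁ p∣q^a = contradiction p∣q^a (prime∤^ pp pq p≢q a)
... | inj₂ p∣m   = p∣m

∃-prime-factor : 1 < n → ∃[ q ] (Prime q × q ∣ n)
∃-prime-factor {n} 1<n with factorise n ⦃ >-nonZero (<-trans z<s 1<n) ⦄
... | record { factors = [] ; isFactorisation = n≡1 } = contradiction (sym n≡1) (<⇒≢ 1<n)
... | record { factors = q ∷ qs ; isFactorisation = eq ; factorsPrime = pq ∷ _ } =
  q , pq , divides (product qs) (trans eq (*-comm q (product qs)))

prime^∣*⇒∣ : Prime p → ¬ p ∣ n → ∀ b {m} → p ^ b ∣ m * n → p ^ b ∣ m
prime^∣*⇒∣ pp p∤n zero    _ = 1∣ _
prime^∣*⇒∣ {p} {n} pp p∤n (suc b) {m} p^1+b∣mn with euclidsLemma m n pp (m*n∣⇒m∣ p (p ^ b) p^1+b∣mn)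
... | inj₂ p∣n = contradiction p∣n p∤n
... | inj₁ (divides m′ refl) =
  subst (p * p ^ b ∣_) (*-comm p m′) (*-monoʳ-∣ p (prime^∣*⇒∣ pp p∤n b p^b∣m′n))
  where
  instance _ = prime⇒nonZero pp
  rearrange : ∀ m′ p n → m′ * p * n ≡ p * (m′ * n)
  rearrange = solve-∀
  p^b∣m′n : p ^ b ∣ m′ * n
  p^b∣m′n = *-cancelˡ-∣ p (subst (p * p ^ b ∣_) (rearrange m′ p n) p^1+b∣mn)

^∤^* : Prime p → ¬ p ∣ m → ∀ a → ¬ p ^ suc a ∣ p ^ a * m
^∤^* {p} {m} pp p∤m a p^1+a∣p^am =
  p∤m (*-cancelˡ-∣ (p ^ a) (subst (_∣ p ^ a * m) (*-comm p (p ^ a)) p^1+a∣p^am))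
  where instance _ = m^n≢0 p a ⦃ prime⇒nonZero pp ⦄

τ : ℕ → ℕ
τ n = count (_∣? n) (suc n)

module _ {p m} (pp : Prime p) (p∤m : ¬ p ∣ m) .⦃ _ : NonZero m ⦄ (a : ℕ) where
  private
    instance
      _ = prime⇒nonZero pp
      _ = m^n≢0 p (suc a)
    p^1+a : ℕ
    p^1+a = p ^ suc a
    X : ℕ
    X = p^1+a * m
    Y : ℕ
    Y = p ^ a * m
    X≡p*Y : X ≡ p * Y
    X≡p*Y = *-assoc p (p ^ a) m

    ∣X∧∤p^1+a⇒∣Y : ∀ {f} → f ∣ X → ¬ p^1+a ∣ f → f ∣ Y
    ∣X∧∤p^1+a⇒∣Y {f} (divides h X≡hf) p^1+a∤f with p ∣? h
    ... | yes (divides h′ refl) = divides h′ (*-cancelˡ-≡ Y (h′ * f) p (begin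
      p * Y        ≡⟨ X≡p*Y ⟨
      X            ≡⟨ X≡hf ⟩
      h′ * p * f   ≡⟨ rearrange h′ p f ⟩
      p * (h′ * f) ∎))
      where
      open ≡-Reasoning
      rearrange : ∀ h′ p f → h′ * p * f ≡ p * (h′ * f)
      rearrange = solve-∀
    ... | no p∤h = contradiction
      (prime^∣*⇒∣ pp p∤h (suc a) (subst (p^1+a ∣_) (trans X≡hf (*-comm h f)) (m∣m*n m))) p^1+a∤f

  τ-step : τ (p ^ suc a * m) ≡ τ (p ^ a * m) + τ m
  τ-step = begin
    τ X
      ≡⟨ count-split (_∣? X) (p^1+a ∣?_) (suc X) ⟩
    count ((_∣? X) ∩? (p^1+a ∣?_)) (suc X) + count ((_∣? X) ∩? ∁? (p^1+a ∣?_)) (suc X)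
      ≡⟨ cong₂ _+_ multiplesOfP others ⟩
    τ m + τ Y
      ≡⟨ +-comm (τ m) (τ Y) ⟩
    τ Y + τ m
      ∎
    where
    open ≡-Reasoning
    multiplesOfP : count ((_∣? X) ∩? (p^1+a ∣?_)) (suc X) ≡ τ m
    multiplesOfP = sym (count-scale (_∣? m) ((_∣? X) ∩? (p^1+a ∣?_)) p^1+a (suc m) (suc X) into onto)
      where
      into : ∀ {g} → g < suc m → g ∣ m → g * p^1+a < suc X × (g * p^1+a ∣ X × p^1+a ∣ g * p^1+a)
      into {g} _ g∣m = s≤s (subst (_≤ X) (*-comm p^1+a g) (*-monoʳ-≤ p^1+a (∣⇒≤ g∣m))) ,
                       subst (_∣ X) (*-comm p^1+a g) (*-monoʳ-∣ p^1+a g∣m) , n∣m*n g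
      onto : ∀ {f} → f < suc X → f ∣ X × p^1+a ∣ f → ∃[ g ] (f ≡ g * p^1+a × g < suc m × g ∣ m)
      onto _ (f∣X , divides g refl) = g , refl , s≤s (∣⇒≤ g∣m) , g∣m
        where
        g∣m : g ∣ m
        g∣m = *-cancelʳ-∣ p^1+a (subst (g * p^1+a ∣_) (*-comm p^1+a m) f∣X)
    others : count ((_∣? X) ∩? ∁? (p^1+a ∣?_)) (suc X) ≡ τ Y
    others = trans (count-cong ((_∣? X) ∩? ∁? (p^1+a ∣?_)) (_∣? Y) (suc X)
                      (λ _ (f∣X , p^1+a∤f) → ∣X∧∤p^1+a⇒∣Y f∣X p^1+a∤f)
                      (λ _ f∣Y → ∣-trans f∣Y (divides p X≡p*Y) ,
                                 λ p^1+a∣f → ^∤^* pp p∤m a (∣-trans p^1+a∣f f∣Y)))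
                   (count-beyond (_∣? Y) (suc X) (s≤s Y≤X) λ Y<f f∣Y → <⇒≱ Y<f (∣⇒≤ f∣Y))
      where
      instance _ = m*n≢0 (p ^ a) m ⦃ m^n≢0 p a ⦄
      Y≤X : Y ≤ X
      Y≤X = subst (Y ≤_) (sym X≡p*Y) (m≤n*m Y p)

τ-^* : Prime p → ¬ p ∣ m → .⦃ _ : NonZero m ⦄ → ∀ a → τ (p ^ a * m) ≡ suc a * τ m
τ-^* {m = m} pp p∤m zero    = trans (cong τ (*-identityˡ m)) (sym (+-identityʳ (τ m)))
τ-^* {p} {m} pp p∤m (suc a) = begin
  τ (p ^ suc a * m)      ≡⟨ τ-step pp p∤m a ⟩
  τ (p ^ a * m) + τ m    ≡⟨ cong (_+ τ m) (τ-^* pp p∤m a) ⟩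
  suc a * τ m + τ m      ≡⟨ +-comm (suc a * τ m) (τ m) ⟩
  suc (suc a) * τ m      ∎
  where open ≡-Reasoning

1≤τ : .⦃ _ : NonZero n ⦄ → 1 ≤ τ n
1≤τ {n} = count-pos (_∣? n) (suc n) ≤-refl ∣-refl

2≤τ : 1 < n → 2 ≤ τ n
2≤τ {n} 1<n = ≤-trans (s≤s (count-pos (_∣? 1) (suc n) (s≤s (<⇒≤ 1<n)) ∣-refl))
                       (count-< (_∣? 1) (_∣? n) (suc n) ≤-refl ∣-refl n∤1 (λ _ x∣1 → ∣-trans x∣1 (1∣ n)))
  where
  n∤1 : ¬ n ∣ 1
  n∤1 n∣1 = <⇒≢ 1<n (sym (∣1⇒≡1 n∣1))

record ExactPower (p a n : ℕ) : Set where
  constructor exactPower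
  field
    cofactor       : ℕ
    n≡p^a*cofactor : n ≡ p ^ a * cofactor
    p∤cofactor     : ¬ p ∣ cofactor

AllPrime : (ℕ → ℕ) → ℕ → Set
AllPrime p k = ∀ i → 1 ≤ i → i ≤ k → Prime (p i)

Distinct : (ℕ → ℕ) → ℕ → Set
Distinct p k = ∀ i j → 1 ≤ i → i ≤ k → 1 ≤ j → j ≤ k → i ≢ j → p i ≢ p j

allPrime-pred : ∀ {p k} → AllPrime p (suc k) → AllPrime p k
allPrime-pred primes i 1≤i i≤k = primes i 1≤i (m≤n⇒m≤1+n i≤k)

distinct-pred : ∀ {p k} → Distinct p (suc k) → Distinct p k
distinct-pred distinct i j 1≤i i≤k 1≤j j≤k = distinct i j 1≤i (m≤n⇒m≤1+n i≤k) 1≤j (m≤n⇒m≤1+n j≤k)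

module _ (p α : ℕ → ℕ) where

  prime∣prodPow : ∀ k → AllPrime p k → Prime q → q ∣ prodPow p α k → ∃[ i ] (1 ≤ i × i ≤ k × q ≡ p i)
  prime∣prodPow zero    _      pq q∣1 = contradiction q∣1 (prime∤1 pq)
  prime∣prodPow (suc k) primes pq q∣prod with euclidsLemma (prodPow p α k) _ pq q∣prod
  ... | inj₂ q∣p^α =
    suc k , s≤s z≤n , ≤-refl , prime∣^⇒≡ pq (primes (suc k) (s≤s z≤n) ≤-refl) (α (suc k)) q∣p^α
  ... | inj₁ q∣prod′ with prime∣prodPow k (allPrime-pred primes) pq q∣prod′
  ...   | i , 1≤i , i≤k , q≡pi = i , 1≤i , m≤n⇒m≤1+n i≤k , q≡pi

  exactPower-prodPow : ∀ k → AllPrime p k → Distinct p k →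
                       ∀ j → 1 ≤ j → j ≤ k → ExactPower (p j) (α j) (prodPow p α k)
  exactPower-prodPow zero    _      _        (suc j) _ ()
  exactPower-prodPow (suc k) primes distinct j 1≤j j≤1+k with j ≟ suc k
  ... | yes refl = exactPower (prodPow p α k) (*-comm (prodPow p α k) _) p∤prod
    where
    p∤prod : ¬ p (suc k) ∣ prodPow p α k
    p∤prod p∣prod with prime∣prodPow k (allPrime-pred primes) (primes j 1≤j ≤-refl) p∣prod
    ... | i , 1≤i , i≤k , p≡pi = distinct j i 1≤j ≤-refl 1≤i (m≤n⇒m≤1+n i≤k) (>⇒≢ (s≤s i≤k)) p≡pi
  ... | no j≢1+k with exactPower-prodPow k (allPrime-pred primes) (distinct-pred distinct)
                        j 1≤j (s≤s⁻¹ (≤∧≢⇒< j≤1+k j≢1+k))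
  ...   | exactPower M prod≡p^α*M p∤M = exactPower (M * p (suc k) ^ α (suc k)) prod≡ p∤M*last
    where
    prod≡ : prodPow p α (suc k) ≡ p j ^ α j * (M * p (suc k) ^ α (suc k))
    prod≡ = trans (cong (_* p (suc k) ^ α (suc k)) prod≡p^α*M) (*-assoc (p j ^ α j) M _)
    p∤M*last : ¬ p j ∣ M * p (suc k) ^ α (suc k)
    p∤M*last p∣ with euclidsLemma M _ (primes j 1≤j j≤1+k) p∣
    ... | inj₁ p∣M    = p∤M p∣M
    ... | inj₂ p∣p^α = distinct j (suc k) 1≤j j≤1+k (s≤s z≤n) ≤-refl j≢1+k
                         (prime∣^⇒≡ (primes j 1≤j j≤1+k) (primes (suc k) (s≤s z≤n) ≤-refl) (α (suc k)) p∣p^α)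

exactPower-pair : Prime p → Prime q → p ≢ q → ∀ {a b} → ExactPower p a n → ExactPower q b n →
                  ∃[ t ] (n ≡ p ^ a * (q ^ b * t) × ¬ p ∣ t × ¬ q ∣ t)
exactPower-pair {p} {q} {n} pp pq p≢q {a} {b}
                (exactPower m n≡p^a*m p∤m) (exactPower m′ n≡q^b*m′ q∤m′) =
  t , trans n≡p^a*m (cong (p ^ a *_) m≡q^b*t) , p∤t , q∤t
  where
  q^b∣n : q ^ b ∣ n
  q^b∣n = divides m′ (trans n≡q^b*m′ (*-comm (q ^ b) m′))
  q^b∣m : q ^ b ∣ m
  q^b∣m = prime^∣*⇒∣ pq (prime∤^ pq pp (p≢q ∘ sym) a) b
            (subst (q ^ b ∣_) (trans n≡p^a*m (*-comm (p ^ a) m)) q^b∣n)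
  t : ℕ
  t = quotient q^b∣m
  m≡q^b*t : m ≡ q ^ b * t
  m≡q^b*t = m∣n⇒n≡m*quotient q^b∣m
  p∤t : ¬ p ∣ t
  p∤t p∣t = p∤m (subst (p ∣_) (sym m≡q^b*t) (∣n⇒∣m*n (q ^ b) p∣t))
  q∤t : ¬ q ∣ t
  q∤t q∣t = ^∤^* pq q∤m′ b (subst (q ^ suc b ∣_) n≡q^b*m′ (∣-trans q^1+b∣m (divides (p ^ a) n≡p^a*m)))
    where
    q^1+b∣m : q ^ suc b ∣ m
    q^1+b∣m = subst₂ _∣_ (*-comm (q ^ b) q) (sym m≡q^b*t) (*-monoʳ-∣ (q ^ b) q∣t)

module DivisorGraph (n : ℕ) ⦃ n≢0 : NonZero n ⦄ where

  -- Bracketed like the two filters in `degree`, so that `degree≡deg` is list bookkeeping.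
  Adjacent : ℕ → ℕ → Set
  Adjacent d e = (1 < e × e ∣ n) × (d ≢ e × n ∣ d * e)

  adjacent? : ∀ d → Decidable (Adjacent d)
  adjacent? d = (λ e → (1 <? e) ×-dec (e ∣? n)) ∩? (λ e → ¬? (d ≟ e) ×-dec (n ∣? d * e))

  deg : ℕ → ℕ
  deg d = count (adjacent? d) n

  degree≡deg : ∀ d → degree n d ≡ deg d
  degree≡deg d = trans (length-filter-filter _ _ (upTo n)) (length-filter-upTo (adjacent? d) n)

  ProperMultiple : ℕ → ℕ → Set
  ProperMultiple q e = e ∣ n × q ∣ e

  properMultiple? : ∀ q → Decidable (ProperMultiple q)
  properMultiple? q e = (e ∣? n) ×-dec (q ∣? e)

  properMultiples : ℕ → ℕ
  properMultiples q = count (properMultiple? q) n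

  *≡n⇒nonZero : d * c ≡ n → NonZero d
  *≡n⇒nonZero {zero} refl = n≢0
  *≡n⇒nonZero {suc d} _   = _

  *≡n⇒∣ : d * c ≡ n → d ∣ n
  *≡n⇒∣ {d} {c} d*c≡n = divides c (trans (sym d*c≡n) (*-comm d c))

  *≡n⇒< : 1 < c → d * c ≡ n → d < n
  *≡n⇒< {c} {d} 1<c d*c≡n = subst (d <_) d*c≡n (m<m*n d c 1<c)
    where instance _ = *≡n⇒nonZero d*c≡n

  suc-properMultiples≡τ : Prime q → d * q ≡ n → suc (properMultiples q) ≡ τ d
  suc-properMultiples≡τ {q} {d} pq d*q≡n = sym (begin
    τ d
      ≡⟨ count-scale (_∣? d) (properMultiple? q) q (suc d) (suc n) into onto ⟩
    count (properMultiple? q) (suc n)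
      ≡⟨ count-suc (properMultiple? q) n (∣-refl , *≡n⇒∣ (trans (*-comm q d) d*q≡n)) ⟩
    suc (properMultiples q)
      ∎)
    where
    open ≡-Reasoning
    instance
      _ = prime⇒nonZero pq
      _ = *≡n⇒nonZero d*q≡n
    into : ∀ {g} → g < suc d → g ∣ d → g * q < suc n × ProperMultiple q (g * q)
    into {g} _ g∣d = s≤s (subst (g * q ≤_) d*q≡n (*-monoˡ-≤ q (∣⇒≤ g∣d))) ,
                     subst (g * q ∣_) d*q≡n (*-monoˡ-∣ q g∣d) , n∣m*n g
    onto : ∀ {f} → f < suc n → ProperMultiple q f → ∃[ g ] (f ≡ g * q × g < suc d × g ∣ d)
    onto _ (f∣n , divides g refl) = g , refl , s≤s (∣⇒≤ g∣d) , g∣d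
      where
      g∣d : g ∣ d
      g∣d = *-cancelʳ-∣ q (subst (g * q ∣_) (sym d*q≡n) f∣n)

  adjacent⇒properMultiple : d * c ≡ n → q ∣ c → Adjacent d e → ProperMultiple q e
  adjacent⇒properMultiple {d} {c} {q} {e} d*c≡n q∣c ((_ , e∣n) , (_ , n∣de)) =
    e∣n , ∣-trans q∣c (*-cancelˡ-∣ d (subst (_∣ d * e) (sym d*c≡n) n∣de))
    where instance _ = *≡n⇒nonZero d*c≡n

  properMultiple⇒adjacent : Prime q → d * q ≡ n → ProperMultiple q e → d ≢ e → Adjacent d e
  properMultiple⇒adjacent {q} {d} {e} pq d*q≡n (e∣n , q∣e) d≢e =
    (<-≤-trans (prime⇒1< pq) (∣⇒≤ q∣e) , e∣n) , d≢e , subst (_∣ d * e) d*q≡n (*-monoʳ-∣ d q∣e)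
    where
    instance
      _ : NonZero e
      _ = ≢-nonZero λ { refl → ≢-nonZero⁻¹ n (0∣⇒≡0 e∣n) }

  deg-cofactor≡count : Prime q → d * q ≡ n → deg d ≡ count (properMultiple? q -? d) n
  deg-cofactor≡count {q} {d} pq d*q≡n = count-cong (adjacent? d) (properMultiple? q -? d) n
    (λ _ adj → adjacent⇒properMultiple d*q≡n ∣-refl adj , proj₁ (proj₂ adj) ∘ sym)
    (λ _ (pm , e≢d) → properMultiple⇒adjacent pq d*q≡n pm (e≢d ∘ sym))

  suc-deg-cofactor : Prime q → d * q ≡ n → q ∣ d → suc (deg d) ≡ properMultiples q
  suc-deg-cofactor {q} {d} pq d*q≡n q∣d = trans (cong suc (deg-cofactor≡count pq d*q≡n))
    (sym (count-remove (properMultiple? q) n (*≡n⇒< (prime⇒1< pq) d*q≡n) (*≡n⇒∣ d*q≡n , q∣d)))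

  deg-cofactor : Prime q → d * q ≡ n → ¬ q ∣ d → deg d ≡ properMultiples q
  deg-cofactor {q} {d} pq d*q≡n q∤d = trans (deg-cofactor≡count pq d*q≡n)
    (count-cong (properMultiple? q -? d) (properMultiple? q) n (λ _ → proj₁)
      (λ _ pm → pm , λ { refl → q∤d (proj₂ pm) }))

  module _ {d c q} (d*c≡n : d * c ≡ n) (q∣c : q ∣ c) where

    1+deg≤properMultiples : ∀ {y} → y < n → ProperMultiple q y → ¬ Adjacent d y →
                            suc (deg d) ≤ properMultiples q
    1+deg≤properMultiples y<n pm ¬adj = count-< (adjacent? d) (properMultiple? q) n y<n pm ¬adj
      (λ _ → adjacent⇒properMultiple d*c≡n q∣c)

    2+deg≤properMultiples : ∀ {y z} → y < n → z < n → y ≢ z → ProperMultiple q y → ProperMultiple q z →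
                            ¬ Adjacent d y → ¬ Adjacent d z → 2 + deg d ≤ properMultiples q
    2+deg≤properMultiples {y} {z} y<n z<n y≢z pmy pmz ¬adj-y ¬adj-z
      rewrite count-remove (properMultiple? q) n y<n pmy =
      s≤s (count-< (adjacent? d) (properMultiple? q -? y) n z<n (pmz , y≢z ∘ sym) ¬adj-z
             λ _ adj → adjacent⇒properMultiple d*c≡n q∣c adj , λ { refl → ¬adj-y adj })

  deg-prime≤1 : Prime q → d * q ≡ n → deg q ≤ 1
  deg-prime≤1 {q} {d} pq d*q≡n = count-≤1 (adjacent? q) n d onlyNeighbour
    where
    instance
      _ = prime⇒nonZero pq
      _ = *≡n⇒nonZero d*q≡n
    onlyNeighbour : ∀ {e} → e < n → Adjacent q e → e ≡ d
    onlyNeighbour {e} e<n ((_ , e∣n) , (_ , n∣qe))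
      with *-cancelˡ-∣ q (subst (_∣ q * e) (trans (sym d*q≡n) (*-comm d q)) n∣qe)
    ... | divides m refl
      with prime⇒irreducible pq {m} (*-cancelʳ-∣ d (subst (m * d ∣_) (trans (sym d*q≡n) (*-comm d q)) e∣n))
    ...   | inj₁ refl = *-identityˡ d
    ...   | inj₂ refl = contradiction (trans (*-comm q d) d*q≡n) (<⇒≢ e<n)

  ¬adjacent-prime : Prime q → d * c ≡ n → q ∣ c → d * q ≢ n → ¬ Adjacent d q
  ¬adjacent-prime {q} {d} pq d*c≡n q∣c d*q≢n (_ , (_ , n∣dq))
    with prime⇒irreducible pq (*-cancelˡ-∣ d (subst (_∣ d * q) (sym d*c≡n) n∣dq))
    where instance _ = *≡n⇒nonZero d*c≡n
  ... | inj₁ refl = prime∤1 pq q∣c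
  ... | inj₂ refl = d*q≢n d*c≡n

  ¬adjacent-cofactor : e * q ≡ n → ¬ q ∣ d → ¬ Adjacent d e
  ¬adjacent-cofactor {e} {q} {d} e*q≡n q∤d (_ , (_ , n∣de)) =
    q∤d (*-cancelˡ-∣ e (subst₂ _∣_ (sym e*q≡n) (*-comm d e) n∣de))
    where instance _ = *≡n⇒nonZero e*q≡n

  cofactor≢prime : Prime q → d * c ≡ n → q ∣ c → 1 < d → ¬ q ∣ d → e * q ≡ n → e ≢ q
  cofactor≢prime {q} {d} pq d*c≡n (divides c′ refl) 1<d q∤d e*q≡n refl
    with prime⇒irreducible pq {d} (divides c′ (*-cancelʳ-≡ q (c′ * d) q (begin
           q * q        ≡⟨ e*q≡n ⟩
           n            ≡⟨ d*c≡n ⟨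
           d * (c′ * q) ≡⟨ rearrange d c′ q ⟩
           c′ * d * q   ∎)))
    where
    instance _ = prime⇒nonZero pq
    open ≡-Reasoning
    rearrange : ∀ d c′ q → d * (c′ * q) ≡ c′ * d * q
    rearrange = solve-∀
  ... | inj₁ refl = <-irrefl refl 1<d
  ... | inj₂ refl = q∤d ∣-refl

  deg-noncofactor : Prime q → d * c ≡ n → q ∣ c → d * q ≢ n → 1 < d → ∀ {D} → D * q ≡ n →
                    suc (deg d) ≤ properMultiples q ×
                    ((deg d ≤ 1 × q ∣ D) ⊎ 2 + deg d ≤ properMultiples q ⊎ ¬ q ∣ D)
  deg-noncofactor {q} {d} {c} pq d*c≡n q∣c d*q≢n 1<d {D} D*q≡n =
    1+deg≤properMultiples d*c≡n q∣c q<n q-multiple ¬adj-q , cases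
    where
    instance _ = *≡n⇒nonZero (trans (*-comm c d) d*c≡n)
    q<n : q < n
    q<n = ≤-<-trans (∣⇒≤ q∣c) (*≡n⇒< 1<d (trans (*-comm c d) d*c≡n))
    q-multiple : ProperMultiple q q
    q-multiple = ∣-trans q∣c (*≡n⇒∣ (trans (*-comm c d) d*c≡n)) , ∣-refl
    ¬adj-q : ¬ Adjacent d q
    ¬adj-q = ¬adjacent-prime pq d*c≡n q∣c d*q≢n
    -- Besides q, a second multiple of q is not adjacent to d: d itself when q ∣ d and d ≢ q,
    -- and the cofactor D when q ∤ d and q ∣ D.
    cases : (deg d ≤ 1 × q ∣ D) ⊎ 2 + deg d ≤ properMultiples q ⊎ ¬ q ∣ D
    cases with q ∣? D
    ... | no q∤D = inj₂ (inj₂ q∤D)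
    ... | yes q∣D with q ∣? d
    ...   | no q∤d = inj₂ (inj₁ (2+deg≤properMultiples d*c≡n q∣c q<n (*≡n⇒< (prime⇒1< pq) D*q≡n)
                        (cofactor≢prime pq d*c≡n q∣c 1<d q∤d D*q≡n ∘ sym) q-multiple (*≡n⇒∣ D*q≡n , q∣D)
                        ¬adj-q (¬adjacent-cofactor D*q≡n q∤d)))
    ...   | yes q∣d with d ≟ q
    ...     | yes refl = inj₁ (deg-prime≤1 {d = D} pq D*q≡n , q∣D)
    ...     | no d≢q = inj₂ (inj₁ (2+deg≤properMultiples d*c≡n q∣c q<n
                        (*≡n⇒< (≤-trans (prime⇒1< pq) (∣⇒≤ q∣c)) d*c≡n) (d≢q ∘ sym)
                        q-multiple (*≡n⇒∣ d*c≡n , q∣d) ¬adj-q λ adj → proj₁ (proj₂ adj) refl))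

  module _ {q m} (pq : Prime q) (q∤m : ¬ q ∣ m) where

    private instance
      _ = prime⇒nonZero pq

    nonZero-cofactor : ∀ a → n ≡ q ^ a * m → NonZero m
    nonZero-cofactor a n≡q^a*m = ≢-nonZero λ { refl → ≢-nonZero⁻¹ n (trans n≡q^a*m (*-zeroʳ (q ^ a))) }

    suc-properMultiples≡*τ : ∀ a .⦃ _ : NonZero a ⦄ → n ≡ q ^ a * m → suc (properMultiples q) ≡ a * τ m
    suc-properMultiples≡*τ (suc a) n≡q^1+a*m =
      trans (suc-properMultiples≡τ {d = q ^ a * m} pq (trans (rearrange q (q ^ a) m) (sym n≡q^1+a*m)))
            (τ-^* pq q∤m ⦃ nonZero-cofactor (suc a) n≡q^1+a*m ⦄ a)
      where
      rearrange : ∀ q r m → r * m * q ≡ q * r * m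
      rearrange = solve-∀

    cofactor≡ : ∀ a → n ≡ q ^ suc a * m → d * q ≡ n → d ≡ q ^ a * m
    cofactor≡ {d} a n≡q^1+a*m d*q≡n =
      *-cancelʳ-≡ d (q ^ a * m) q (trans d*q≡n (trans n≡q^1+a*m (rearrange q (q ^ a) m)))
      where
      rearrange : ∀ q r m → q * r * m ≡ r * m * q
      rearrange = solve-∀

    ∤cofactor : n ≡ q ^ 1 * m → d * q ≡ n → ¬ q ∣ d
    ∤cofactor n≡q*m d*q≡n q∣d = q∤m (subst (q ∣_) (trans (cofactor≡ 0 n≡q*m d*q≡n) (*-identityˡ m)) q∣d)

    ∣cofactor : ∀ {a} → 2 ≤ a → n ≡ q ^ a * m → d * q ≡ n → q ∣ d
    ∣cofactor {d} {suc (suc a)} (s≤s (s≤s _)) n≡q^2+a*m d*q≡n =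
      subst (q ∣_) (trans (sym (*-assoc q (q ^ a) m)) (sym (cofactor≡ (suc a) n≡q^2+a*m d*q≡n)))
            (m∣m*n (q ^ a * m))

  ∃-cofactor : ∀ {a m} → 1 ≤ a → n ≡ q ^ a * m → ∃[ d ] d * q ≡ n
  ∃-cofactor {q} {suc a} {m} _ n≡q^1+a*m = q ^ a * m , trans (rearrange q (q ^ a) m) (sym n≡q^1+a*m)
    where
    rearrange : ∀ q r m → r * m * q ≡ q * r * m
    rearrange = solve-∀

*-gap : ∀ {a b t s r} → b ≤ a → suc s ≡ a * (suc b * t) → suc r ≡ b * (suc a * t) → s ≡ r + (a ∸ b) * t
*-gap {a} {b} {t} {s} {r} b≤a suc-s≡ suc-r≡ = suc-injective (begin
  suc s                           ≡⟨ suc-s≡ ⟩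
  a * (suc b * t)                 ≡⟨ cong (λ x → x * (suc b * t)) (m+[n∸m]≡n b≤a) ⟨
  (b + δ) * (suc b * t)           ≡⟨ expand b δ t ⟩
  b * (suc (b + δ) * t) + δ * t   ≡⟨ cong (λ x → b * (suc x * t) + δ * t) (m+[n∸m]≡n b≤a) ⟩
  b * (suc a * t) + δ * t         ≡⟨ cong (_+ δ * t) suc-r≡ ⟨
  suc r + δ * t                   ∎)
  where
  open ≡-Reasoning
  δ : ℕ
  δ = a ∸ b
  expand : ∀ b δ t → (b + δ) * (suc b * t) ≡ b * (suc (b + δ) * t) + δ * t
  expand = solve-∀

2≤[a∸1]*t : ∀ {a t} → 2 ≤ a → 1 ≤ t → (a ≡ 2 → 2 ≤ t) → 2 ≤ (a ∸ 1) * t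
2≤[a∸1]*t {2} (s≤s (s≤s z≤n)) _ 2≤t = subst (2 ≤_) (sym (+-identityʳ _)) (2≤t refl)
2≤[a∸1]*t {suc (2+ a)} {t} _ 1≤t _  = *-mono-≤ {2} {2+ a} {1} {t} (s≤s (s≤s z≤n)) 1≤t

module MaxDegree {n k : ℕ} {p α : ℕ → ℕ} (n-composite : Composite n) (1≤k : 1 ≤ k)
  (primes : AllPrime p k) (distinct : Distinct p k)
  (1≤α : ∀ i → 1 ≤ i → i ≤ k → 1 ≤ α i)
  (α-antitone : ∀ i j → 1 ≤ i → i ≤ j → j ≤ k → α j ≤ α i)
  (n≡prodPow : n ≡ prodPow p α k) where

  instance n≢0 = composite⇒nonZero n-composite
  open DivisorGraph n public

  S : ℕ → ℕ
  S j = properMultiples (p j)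

  module _ {j} (1≤j : 1 ≤ j) (j≤k : j ≤ k) where

    exact : ExactPower (p j) (α j) n
    exact = subst (ExactPower (p j) (α j)) (sym n≡prodPow) (exactPower-prodPow p α k primes distinct j 1≤j j≤k)

    open ExactPower exact renaming (cofactor to M)
    private
      instance _ = >-nonZero (1≤α j 1≤j j≤k)
      pj : Prime (p j)
      pj = primes j 1≤j j≤k

    cofactor-exists : ∃[ X ] X * p j ≡ n
    cofactor-exists = ∃-cofactor (1≤α j 1≤j j≤k) n≡p^a*cofactor

    α≡1⇒∤cofactor : ∀ {X} → α j ≡ 1 → X * p j ≡ n → ¬ p j ∣ X
    α≡1⇒∤cofactor α≡1 = ∤cofactor pj p∤cofactor (subst (λ a → n ≡ p j ^ a * M) α≡1 n≡p^a*cofactor)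

    2≤α⇒∣cofactor : ∀ {X} → 2 ≤ α j → X * p j ≡ n → p j ∣ X
    2≤α⇒∣cofactor 2≤α = ∣cofactor pj p∤cofactor 2≤α n≡p^a*cofactor

    deg-cofactor-α≡1 : ∀ {X} → α j ≡ 1 → X * p j ≡ n → deg X ≡ S j
    deg-cofactor-α≡1 α≡1 X*p≡n = deg-cofactor pj X*p≡n (α≡1⇒∤cofactor α≡1 X*p≡n)

    suc-deg-cofactor-2≤α : ∀ {X} → 2 ≤ α j → X * p j ≡ n → suc (deg X) ≡ S j
    suc-deg-cofactor-2≤α 2≤α X*p≡n = suc-deg-cofactor pj X*p≡n (2≤α⇒∣cofactor 2≤α X*p≡n)

    p∣n : p j ∣ n
    p∣n = divides (proj₁ cofactor-exists) (sym (proj₂ cofactor-exists))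

    α≤1+S : α j ≤ suc (S j)
    α≤1+S = subst₂ _≤_ (*-identityʳ (α j)) (sym (suc-properMultiples≡*τ pj p∤cofactor (α j) n≡p^a*cofactor))
                       (*-monoʳ-≤ (α j) (1≤τ {M}))
      where instance _ = nonZero-cofactor pj p∤cofactor (α j) n≡p^a*cofactor

    α≡1⊎2≤α : α j ≡ 1 ⊎ 2 ≤ α j
    α≡1⊎2≤α with m≤n⇒m<n∨m≡n (1≤α j 1≤j j≤k)
    ... | inj₁ 1<α = inj₂ 1<α
    ... | inj₂ 1≡α = inj₁ (sym 1≡α)

  module Pair {j} (2≤j : 2 ≤ j) (j≤k : j ≤ k) where
    private
      1≤j : 1 ≤ j
      1≤j = ≤-trans (s≤s z≤n) 2≤j
      p₁ : Prime (p 1)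
      p₁ = primes 1 ≤-refl 1≤k
      pj : Prime (p j)
      pj = primes j 1≤j j≤k
      p₁≢pj : p 1 ≢ p j
      p₁≢pj = distinct 1 j ≤-refl 1≤k 1≤j j≤k (<⇒≢ 2≤j)
      pairing : ∃[ t ] (n ≡ p 1 ^ α 1 * (p j ^ α j * t) × ¬ p 1 ∣ t × ¬ p j ∣ t)
      pairing = exactPower-pair p₁ pj p₁≢pj (exact ≤-refl 1≤k) (exact 1≤j j≤k)
      instance
        _ = >-nonZero (1≤α 1 ≤-refl 1≤k)
        _ = >-nonZero (1≤α j 1≤j j≤k)

    T : ℕ
    T = proj₁ pairing

    private
      n≡p₁^α*pj^α*T : n ≡ p 1 ^ α 1 * (p j ^ α j * T)
      n≡p₁^α*pj^α*T = proj₁ (proj₂ pairing)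
      p₁∤T : ¬ p 1 ∣ T
      p₁∤T = proj₁ (proj₂ (proj₂ pairing))
      pj∤T : ¬ p j ∣ T
      pj∤T = proj₂ (proj₂ (proj₂ pairing))

    instance
      T≢0 : NonZero T
      T≢0 = m*n≢0⇒n≢0 (p j ^ α j) ⦃ m*n≢0⇒n≢0 (p 1 ^ α 1) ⦃ subst NonZero n≡p₁^α*pj^α*T n≢0 ⦄ ⦄

    suc-S₁≡ : suc (S 1) ≡ α 1 * (suc (α j) * τ T)
    suc-S₁≡ = trans (suc-properMultiples≡*τ p₁ p₁∤ (α 1) n≡p₁^α*pj^α*T) (cong (α 1 *_) (τ-^* pj pj∤T (α j)))
      where
      p₁∤ : ¬ p 1 ∣ p j ^ α j * T
      p₁∤ = p₁∤T ∘ prime∣^*⇒∣ p₁ pj p₁≢pj (α j)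

    suc-Sj≡ : suc (S j) ≡ α j * (suc (α 1) * τ T)
    suc-Sj≡ = trans (suc-properMultiples≡*τ pj pj∤ (α j) n≡pj^α*p₁^α*T) (cong (α j *_) (τ-^* p₁ p₁∤T (α 1)))
      where
      rearrange : ∀ a b t → a * (b * t) ≡ b * (a * t)
      rearrange = solve-∀
      n≡pj^α*p₁^α*T : n ≡ p j ^ α j * (p 1 ^ α 1 * T)
      n≡pj^α*p₁^α*T = trans n≡p₁^α*pj^α*T (rearrange (p 1 ^ α 1) (p j ^ α j) T)
      pj∤ : ¬ p j ∣ p 1 ^ α 1 * T
      pj∤ = pj∤T ∘ prime∣^*⇒∣ pj p₁ (p₁≢pj ∘ sym) (α 1)

    private
      divisible-by : ∀ l → 1 ≤ l → l ≤ k → l ≢ 1 → l ≢ j → 1 < T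
      divisible-by l 1≤l l≤k l≢1 l≢j = <-≤-trans (prime⇒1< pl) (∣⇒≤ pl∣T)
        where
        pl : Prime (p l)
        pl = primes l 1≤l l≤k
        pl∣T : p l ∣ T
        pl∣T = prime∣^*⇒∣ pl pj (distinct l j 1≤l l≤k 1≤j j≤k l≢j) (α j)
                 (prime∣^*⇒∣ pl p₁ (distinct l 1 1≤l l≤k ≤-refl 1≤k l≢1) (α 1)
                   (subst (p l ∣_) n≡p₁^α*pj^α*T (p∣n 1≤l l≤k)))

    1<T : 3 ≤ k → 1 < T
    1<T 3≤k with j ≟ 2
    ... | yes refl = divisible-by 3 (s≤s z≤n) 3≤k (λ ()) (λ ())
    ... | no j≢2   = divisible-by 2 (s≤s z≤n) (≤-trans (n≤1+n 2) 3≤k) (λ ()) (j≢2 ∘ sym)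

  gap : ∀ {j} → 1 ≤ j → j ≤ k → ∃[ t ] (1 ≤ t × (3 ≤ k → 2 ≤ t) × S 1 ≡ S j + (α 1 ∸ α j) * t)
  gap {j} 1≤j j≤k with j ≟ 1
  ... | yes refl = -- the gap vanishes, so any t will do
    2 , s≤s z≤n , (λ _ → ≤-refl) , sym (trans (cong (λ x → S 1 + x * 2) (n∸n≡0 (α 1))) (+-identityʳ (S 1)))
  ... | no j≢1 = τ T , 1≤τ {T} , 2≤τ ∘ 1<T , *-gap (α-antitone 1 j ≤-refl 1≤j j≤k) suc-S₁≡ suc-Sj≡
    where open Pair (≤∧≢⇒< 1≤j (j≢1 ∘ sym)) j≤k

  module _ {j} (1≤j : 1 ≤ j) (j≤k : j ≤ k) where

    S≤S₁ : S j ≤ S 1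
    S≤S₁ with gap 1≤j j≤k
    ... | t , _ , _ , S₁≡ = subst (S j ≤_) (sym S₁≡) (m≤m+n (S j) _)

    S≡S₁ : α j ≡ α 1 → S j ≡ S 1
    S≡S₁ αj≡α₁ with gap 1≤j j≤k
    ... | t , _ , _ , S₁≡ = sym (begin
      S 1                     ≡⟨ S₁≡ ⟩
      S j + (α 1 ∸ α j) * t   ≡⟨ cong (λ x → S j + (α 1 ∸ x) * t) αj≡α₁ ⟩
      S j + (α 1 ∸ α 1) * t   ≡⟨ cong (λ x → S j + x * t) (n∸n≡0 (α 1)) ⟩
      S j + 0                 ≡⟨ +-identityʳ (S j) ⟩
      S j                     ∎)
      where open ≡-Reasoning

    1+S≤S₁ : α j < α 1 → suc (S j) ≤ S 1
    1+S≤S₁ αj<α₁ with gap 1≤j j≤k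
    ... | t , 1≤t , _ , S₁≡ = subst (suc (S j) ≤_) (sym S₁≡)
      (subst (_≤ S j + (α 1 ∸ α j) * t) (+-comm (S j) 1) (+-monoʳ-≤ (S j) (*-mono-≤ (m<n⇒0<n∸m αj<α₁) 1≤t)))

    2+S≤S₁ : α j ≡ 1 → 2 ≤ α 1 → ¬ (k ≡ 2 × α 1 ≡ 2 × α 2 ≡ 1) → 2 + S j ≤ S 1
    2+S≤S₁ αj≡1 2≤α₁ not-p²q with gap 1≤j j≤k
    ... | t , 1≤t , [3≤k⇒2≤t] , S₁≡ = subst (2 + S j ≤_) (sym S₁≡)
      (subst (_≤ S j + (α 1 ∸ α j) * t) (+-comm (S j) 2)
        (+-monoʳ-≤ (S j) (subst (λ a → 2 ≤ (α 1 ∸ a) * t) (sym αj≡1) (2≤[a∸1]*t 2≤α₁ 1≤t α₁≡2⇒2≤t))))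
      where
      2≤j : 2 ≤ j
      2≤j = ≤∧≢⇒< 1≤j λ { refl → <⇒≢ 2≤α₁ (sym αj≡1) }
      α₁≡2⇒2≤t : α 1 ≡ 2 → 2 ≤ t
      α₁≡2⇒2≤t α₁≡2 with k ≟ 2
      ... | yes refl = contradiction (refl , α₁≡2 , subst (λ i → α i ≡ 1) (≤-antisym j≤k 2≤j) αj≡1) not-p²q
      ... | no k≢2   = [3≤k⇒2≤t] (≤∧≢⇒< (≤-trans 2≤j j≤k) (k≢2 ∘ sym))

  classify : ∀ {e} → IsProperDivisor n e → ∃[ j ] (1 ≤ j × j ≤ k × ∃[ c ] (e * c ≡ n × p j ∣ c))
  classify {e} (1<e , e<n , divides c n≡c*e) with ∃-prime-factor 1<c
    where
    1<c : 1 < c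
    1<c = ≤∧≢⇒< (n≢0⇒n>0 λ { refl → ≢-nonZero⁻¹ n n≡c*e })
                λ { refl → <⇒≢ e<n (sym (trans n≡c*e (*-identityˡ e))) }
  ... | q , pq , q∣c
    with prime∣prodPow p α k primes pq (subst (q ∣_) n≡prodPow (∣-trans q∣c (divides e (trans n≡c*e (*-comm c e)))))
  ...   | j , 1≤j , j≤k , refl = j , 1≤j , j≤k , c , trans (*-comm e c) (sym n≡c*e) , q∣c

  cofactor-proper : ∀ {j X} → 1 ≤ j → j ≤ k → X * p j ≡ n → IsProperDivisor n X
  cofactor-proper {j} {X} 1≤j j≤k X*p≡n = 1<X , *≡n⇒< (prime⇒1< pj) X*p≡n , *≡n⇒∣ X*p≡n
    where
    pj : Prime (p j)
    pj = primes j 1≤j j≤k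
    1<X : 1 < X
    1<X = ≤∧≢⇒< (>-nonZero⁻¹ X ⦃ *≡n⇒nonZero X*p≡n ⦄)
            λ { refl → composite⇒¬prime n-composite (subst Prime (trans (sym (*-identityˡ (p j))) X*p≡n) pj) }

  module TopVertex {X} (X*p₁≡n : X * p 1 ≡ n) where
    private
      1≤1 : 1 ≤ 1
      1≤1 = ≤-refl {1}

    deg-top : (α 1 ≡ 1 × deg X ≡ S 1) ⊎ (2 ≤ α 1 × suc (deg X) ≡ S 1)
    deg-top with α≡1⊎2≤α 1≤1 1≤k
    ... | inj₁ α₁≡1 = inj₁ (α₁≡1 , deg-cofactor-α≡1 1≤1 1≤k α₁≡1 X*p₁≡n)
    ... | inj₂ 2≤α₁ = inj₂ (2≤α₁ , suc-deg-cofactor-2≤α 1≤1 1≤k 2≤α₁ X*p₁≡n)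

    S₁≤1+deg : S 1 ≤ suc (deg X)
    S₁≤1+deg with deg-top
    ... | inj₁ (_ , deg≡S₁)   = subst (_≤ suc (deg X)) deg≡S₁ (n≤1+n (deg X))
    ... | inj₂ (_ , 1+deg≡S₁) = ≤-reflexive (sym 1+deg≡S₁)

    1+deg≡S₁ : 2 ≤ α 1 → suc (deg X) ≡ S 1
    1+deg≡S₁ 2≤α₁ = suc-deg-cofactor-2≤α 1≤1 1≤k 2≤α₁ X*p₁≡n

    module _ {j e} (1≤j : 1 ≤ j) (j≤k : j ≤ k) (e*pj≡n : e * p j ≡ n) where

      deg-cofactor≡ : α j ≡ α 1 → deg e ≡ deg X
      deg-cofactor≡ αj≡α₁ with α≡1⊎2≤α 1≤j j≤k
      ... | inj₁ αj≡1 = begin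
        deg e ≡⟨ deg-cofactor-α≡1 1≤j j≤k αj≡1 e*pj≡n ⟩
        S j   ≡⟨ S≡S₁ 1≤j j≤k αj≡α₁ ⟩
        S 1   ≡⟨ deg-cofactor-α≡1 1≤1 1≤k (trans (sym αj≡α₁) αj≡1) X*p₁≡n ⟨
        deg X ∎
        where open ≡-Reasoning
      ... | inj₂ 2≤αj = suc-injective (begin
        suc (deg e) ≡⟨ suc-deg-cofactor-2≤α 1≤j j≤k 2≤αj e*pj≡n ⟩
        S j         ≡⟨ S≡S₁ 1≤j j≤k αj≡α₁ ⟩
        S 1         ≡⟨ 1+deg≡S₁ (subst (2 ≤_) αj≡α₁ 2≤αj) ⟨
        suc (deg X) ∎)
        where open ≡-Reasoning

      private
        αj<α₁⇒2≤α₁ : α j < α 1 → 2 ≤ α 1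
        αj<α₁⇒2≤α₁ = ≤-trans (s≤s (1≤α j 1≤j j≤k))

        deg-cofactor<-2≤α : α j < α 1 → 2 ≤ α j → deg e < deg X
        deg-cofactor<-2≤α αj<α₁ 2≤αj = s≤s⁻¹ (begin-strict
          suc (deg e) ≡⟨ suc-deg-cofactor-2≤α 1≤j j≤k 2≤αj e*pj≡n ⟩
          S j         <⟨ 1+S≤S₁ 1≤j j≤k αj<α₁ ⟩
          S 1         ≡⟨ 1+deg≡S₁ (αj<α₁⇒2≤α₁ αj<α₁) ⟨
          suc (deg X) ∎)
          where open ≤-Reasoning

      deg-cofactor≤ : deg e ≤ deg X
      deg-cofactor≤ with m≤n⇒m<n∨m≡n (α-antitone 1 j ≤-refl 1≤j j≤k) | α≡1⊎2≤α 1≤j j≤k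
      ... | inj₂ αj≡α₁ | _         = ≤-reflexive (deg-cofactor≡ αj≡α₁)
      ... | inj₁ αj<α₁ | inj₂ 2≤αj = <⇒≤ (deg-cofactor<-2≤α αj<α₁ 2≤αj)
      ... | inj₁ αj<α₁ | inj₁ αj≡1 = s≤s⁻¹ (begin
        suc (deg e) ≡⟨ cong suc (deg-cofactor-α≡1 1≤j j≤k αj≡1 e*pj≡n) ⟩
        suc (S j)   ≤⟨ 1+S≤S₁ 1≤j j≤k αj<α₁ ⟩
        S 1         ≡⟨ 1+deg≡S₁ (αj<α₁⇒2≤α₁ αj<α₁) ⟨
        suc (deg X) ∎)
        where open ≤-Reasoning

      deg-cofactor< : α j < α 1 → ¬ (k ≡ 2 × α 1 ≡ 2 × α 2 ≡ 1) → deg e < deg X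
      deg-cofactor< αj<α₁ not-p²q with α≡1⊎2≤α 1≤j j≤k
      ... | inj₂ 2≤αj = deg-cofactor<-2≤α αj<α₁ 2≤αj
      ... | inj₁ αj≡1 = s≤s⁻¹ (begin
        2 + deg e   ≡⟨ cong (2 +_) (deg-cofactor-α≡1 1≤j j≤k αj≡1 e*pj≡n) ⟩
        2 + S j     ≤⟨ 2+S≤S₁ 1≤j j≤k αj≡1 (αj<α₁⇒2≤α₁ αj<α₁) not-p²q ⟩
        S 1         ≡⟨ 1+deg≡S₁ (αj<α₁⇒2≤α₁ αj<α₁) ⟨
        suc (deg X) ∎)
        where open ≤-Reasoning

    2≤deg : (k ≡ 1 → 3 ≤ α 1) → ¬ (k ≡ 1 × α 1 ≡ 3) → 2 ≤ α 1 → 2 ≤ deg X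
    2≤deg k≡1⇒3≤α₁ not-p³ 2≤α₁ = s≤s⁻¹ (s≤s⁻¹ (subst (4 ≤_) (cong suc (sym (1+deg≡S₁ 2≤α₁))) 4≤1+S₁))
      where
      4≤1+S₁ : 4 ≤ suc (S 1)
      4≤1+S₁ with k ≟ 1
      ... | yes k≡1 = ≤-trans (≤∧≢⇒< (k≡1⇒3≤α₁ k≡1) λ 3≡α₁ → not-p³ (k≡1 , sym 3≡α₁)) (α≤1+S 1≤1 1≤k)
      ... | no k≢1  = subst (4 ≤_) (sym suc-S₁≡) (*-mono-≤ 2≤α₁ (*-mono-≤ (s≤s (1≤α 2 (s≤s z≤n) 2≤k)) (1≤τ {T})))
        where
        2≤k : 2 ≤ k
        2≤k = ≤∧≢⇒< 1≤k (k≢1 ∘ sym)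
        open Pair ≤-refl 2≤k

    module _ {e j c} (e-proper : IsProperDivisor n e) (1≤j : 1 ≤ j) (j≤k : j ≤ k)
             (e*c≡n : e * c ≡ n) (pj∣c : p j ∣ c) (e*pj≢n : e * p j ≢ n) where
      private
        D : ℕ
        D = proj₁ (cofactor-exists 1≤j j≤k)
        D*pj≡n : D * p j ≡ n
        D*pj≡n = proj₂ (cofactor-exists 1≤j j≤k)
        bounds : suc (deg e) ≤ S j × ((deg e ≤ 1 × p j ∣ D) ⊎ 2 + deg e ≤ S j ⊎ ¬ p j ∣ D)
        bounds = deg-noncofactor (primes j 1≤j j≤k) e*c≡n pj∣c e*pj≢n (proj₁ e-proper) {D} D*pj≡n

      deg-noncofactor≤ : deg e ≤ deg X
      deg-noncofactor≤ = s≤s⁻¹ (≤-trans (proj₁ bounds) (≤-trans (S≤S₁ 1≤j j≤k) S₁≤1+deg))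

      deg-noncofactor< : (k ≡ 1 → 3 ≤ α 1) → ¬ (k ≡ 1 × α 1 ≡ 3) → deg e < deg X
      deg-noncofactor< k≡1⇒3≤α₁ not-p³ with proj₂ bounds
      ... | inj₁ (deg≤1 , pj∣D) =
        ≤-<-trans deg≤1 (2≤deg k≡1⇒3≤α₁ not-p³ (≤-trans 2≤αj (α-antitone 1 j ≤-refl 1≤j j≤k)))
        where
        2≤αj : 2 ≤ α j
        2≤αj with α≡1⊎2≤α 1≤j j≤k
        ... | inj₁ αj≡1 = contradiction pj∣D (α≡1⇒∤cofactor 1≤j j≤k αj≡1 D*pj≡n)
        ... | inj₂ 2≤αj = 2≤αj
      ... | inj₂ (inj₁ 2+deg≤Sj) = s≤s⁻¹ (≤-trans 2+deg≤Sj (≤-trans (S≤S₁ 1≤j j≤k) S₁≤1+deg))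
      ... | inj₂ (inj₂ pj∤D) = <-≤-trans (proj₁ bounds) Sj≤deg
        where
        αj≡1 : α j ≡ 1
        αj≡1 with α≡1⊎2≤α 1≤j j≤k
        ... | inj₁ αj≡1 = αj≡1
        ... | inj₂ 2≤αj = contradiction (2≤α⇒∣cofactor 1≤j j≤k 2≤αj D*pj≡n) pj∤D
        Sj≤deg : S j ≤ deg X
        Sj≤deg with deg-top
        ... | inj₁ (_ , deg≡S₁) = subst (S j ≤_) (sym deg≡S₁) (S≤S₁ 1≤j j≤k)
        ... | inj₂ (2≤α₁ , 1+deg≡S₁) =
          s≤s⁻¹ (subst (suc (S j) ≤_) (sym 1+deg≡S₁) (1+S≤S₁ 1≤j j≤k (subst (_< α 1) (sym αj≡1) 2≤α₁)))

    deg≤ : ∀ {e} → IsProperDivisor n e → deg e ≤ deg X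
    deg≤ {e} e-proper with classify e-proper
    ... | j , 1≤j , j≤k , c , e*c≡n , pj∣c with e * p j ≟ n
    ...   | yes e*pj≡n = deg-cofactor≤ 1≤j j≤k e*pj≡n
    ...   | no e*pj≢n  = deg-noncofactor≤ e-proper 1≤j j≤k e*c≡n pj∣c e*pj≢n

    cofactor⊎deg< : (k ≡ 1 → 3 ≤ α 1) → ¬ (k ≡ 1 × α 1 ≡ 3) → ∀ {e} → IsProperDivisor n e →
                    (∃[ j ] (1 ≤ j × j ≤ k × e * p j ≡ n)) ⊎ deg e < deg X
    cofactor⊎deg< k≡1⇒3≤α₁ not-p³ {e} e-proper with classify e-proper
    ... | j , 1≤j , j≤k , c , e*c≡n , pj∣c with e * p j ≟ n
    ...   | yes e*pj≡n = inj₁ (j , 1≤j , j≤k , e*pj≡n)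
    ...   | no e*pj≢n  = inj₂ (deg-noncofactor< e-proper 1≤j j≤k e*c≡n pj∣c e*pj≢n k≡1⇒3≤α₁ not-p³)

    maxDegree-of : ∀ {d} → IsProperDivisor n d → deg X ≤ deg d → IsMaxDegree n d
    maxDegree-of {d} d-proper degX≤degd = d-proper , λ e e-proper →
      subst₂ _≤_ (sym (degree≡deg e)) (sym (degree≡deg d)) (≤-trans (deg≤ e-proper) degX≤degd)

    top-max : IsMaxDegree n X
    top-max = maxDegree-of (cofactor-proper ≤-refl 1≤k X*p₁≡n) ≤-refl

    maxDegree⇒deg≤ : ∀ {d} → IsMaxDegree n d → deg X ≤ deg d
    maxDegree⇒deg≤ {d} (_ , maximal) =
      subst₂ _≤_ (degree≡deg X) (degree≡deg d) (maximal X (cofactor-proper ≤-refl 1≤k X*p₁≡n))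

  part-iii : (k ≡ 1 → 3 ≤ α 1) → ¬ (k ≡ 1 × α 1 ≡ 3) → ¬ (k ≡ 2 × α 1 ≡ 2 × α 2 ≡ 1) →
             ∀ t → 1 ≤ t → t ≤ k → α t ≡ α 1 → (∀ j → t < j → j ≤ k → α j ≢ α 1) →
             ∀ d → IsMaxDegree n d ⇔ (∃[ i ] (1 ≤ i × i ≤ t × d * p i ≡ n))
  part-iii k≡1⇒3≤α₁ not-p³ not-p²q t 1≤t t≤k αt≡α₁ α≢α₁-beyond-t d = mk⇔ to from
    where
    open TopVertex {proj₁ (cofactor-exists ≤-refl 1≤k)} (proj₂ (cofactor-exists ≤-refl 1≤k))
    to : IsMaxDegree n d → ∃[ i ] (1 ≤ i × i ≤ t × d * p i ≡ n)
    to d-max with cofactor⊎deg< k≡1⇒3≤α₁ not-p³ (proj₁ d-max)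
    ... | inj₂ d<X = contradiction (maxDegree⇒deg≤ d-max) (<⇒≱ d<X)
    ... | inj₁ (j , 1≤j , j≤k , d*pj≡n) with α j ≟ α 1
    ...   | no αj≢α₁ = contradiction (maxDegree⇒deg≤ d-max)
                         (<⇒≱ (deg-cofactor< 1≤j j≤k d*pj≡n (≤∧≢⇒< (α-antitone 1 j ≤-refl 1≤j j≤k) αj≢α₁) not-p²q))
    ...   | yes αj≡α₁ with j ≤? t
    ...     | yes j≤t = j , 1≤j , j≤t , d*pj≡n
    ...     | no j≰t  = contradiction αj≡α₁ (α≢α₁-beyond-t j (≰⇒> j≰t) j≤k)
    from : ∃[ i ] (1 ≤ i × i ≤ t × d * p i ≡ n) → IsMaxDegree n d
    from (i , 1≤i , i≤t , d*pi≡n) =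
      maxDegree-of (cofactor-proper 1≤i i≤k d*pi≡n) (≤-reflexive (sym (deg-cofactor≡ 1≤i i≤k d*pi≡n αi≡α₁)))
      where
      i≤k : i ≤ k
      i≤k = ≤-trans i≤t t≤k
      αi≡α₁ : α i ≡ α 1
      αi≡α₁ = ≤-antisym (α-antitone 1 i ≤-refl 1≤i i≤k) (subst (_≤ α i) αt≡α₁ (α-antitone i t 1≤i i≤t t≤k))

  part-i : k ≡ 1 → α 1 ≡ 3 → IsMaxDegree n (p 1) × IsMaxDegree n (p 1 ^ 2)
  part-i refl α₁≡3 = maxDegree-of p₁-proper (subst (_≤ deg (p 1)) (sym deg-p₁²≡1) 1≤deg-p₁) , top-max
    where
    p₁ : Prime (p 1)
    p₁ = primes 1 ≤-refl 1≤k
    n≡p₁³ : n ≡ p 1 ^ 3 * 1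
    n≡p₁³ = trans n≡prodPow (trans (*-identityˡ _) (trans (cong (p 1 ^_) α₁≡3) (sym (*-identityʳ _))))
    p₁²*p₁≡n : p 1 ^ 2 * p 1 ≡ n
    p₁²*p₁≡n = trans (*-comm (p 1 ^ 2) (p 1)) (trans (sym (*-identityʳ (p 1 ^ 3))) (sym n≡p₁³))
    open TopVertex {p 1 ^ 2} p₁²*p₁≡n
    deg-p₁²≡1 : deg (p 1 ^ 2) ≡ 1
    deg-p₁²≡1 = suc-injective (suc-injective (begin
      2 + deg (p 1 ^ 2) ≡⟨ cong suc (1+deg≡S₁ (subst (2 ≤_) (sym α₁≡3) (s≤s (s≤s z≤n)))) ⟩
      suc (S 1)         ≡⟨ suc-properMultiples≡*τ p₁ (prime∤1 p₁) 3 n≡p₁³ ⟩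
      3 * τ 1           ∎))
      where open ≡-Reasoning
    p₁²-proper : IsProperDivisor n (p 1 ^ 2)
    p₁²-proper = cofactor-proper ≤-refl 1≤k p₁²*p₁≡n
    p₁*p₁²≡n : p 1 * p 1 ^ 2 ≡ n
    p₁*p₁²≡n = trans (*-comm (p 1) (p 1 ^ 2)) p₁²*p₁≡n
    p₁-proper : IsProperDivisor n (p 1)
    p₁-proper = prime⇒1< p₁ , *≡n⇒< (proj₁ p₁²-proper) p₁*p₁²≡n , *≡n⇒∣ p₁*p₁²≡n
    p₁<p₁² : p 1 < p 1 ^ 2
    p₁<p₁² = m<m*n (p 1) (p 1 ^ 1) (subst (1 <_) (sym (*-identityʳ (p 1))) (prime⇒1< p₁))
      where instance _ = prime⇒nonZero p₁
    1≤deg-p₁ : 1 ≤ deg (p 1)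
    1≤deg-p₁ = count-pos (adjacent? (p 1)) n (proj₁ (proj₂ p₁²-proper))
      ((proj₁ p₁²-proper , proj₂ (proj₂ p₁²-proper)) , <⇒≢ p₁<p₁² , subst (n ∣_) (sym p₁*p₁²≡n) ∣-refl)

  part-ii : k ≡ 2 → α 1 ≡ 2 → α 2 ≡ 1 → ∀ d → IsMaxDegree n d ⇔ (d ≡ p 1 * p 2 ⊎ d ≡ p 1 ^ 2)
  part-ii refl α₁≡2 α₂≡1 d = mk⇔ to from
    where
    1≤2 : 1 ≤ 2
    1≤2 = s≤s (z≤n {1})
    p₁ : Prime (p 1)
    p₁ = primes 1 ≤-refl 1≤k
    p₂ : Prime (p 2)
    p₂ = primes 2 1≤2 ≤-refl
    p₁≢p₂ : p 1 ≢ p 2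
    p₁≢p₂ = distinct 1 2 ≤-refl 1≤k 1≤2 ≤-refl (λ ())
    instance
      _ = prime⇒nonZero p₁
      _ = prime⇒nonZero p₂
    n≡p₁²*p₂ : n ≡ p 1 ^ 2 * p 2
    n≡p₁²*p₂ = trans n≡prodPow (trans (cong₂ (λ a b → 1 * p 1 ^ a * p 2 ^ b) α₁≡2 α₂≡1)
                                       (cong₂ _*_ (*-identityˡ (p 1 ^ 2)) (*-identityʳ (p 2))))
    p₁p₂*p₁≡n : p 1 * p 2 * p 1 ≡ n
    p₁p₂*p₁≡n = trans (rearrange (p 1) (p 2)) (sym n≡p₁²*p₂)
      where
      rearrange : ∀ a b → a * b * a ≡ a * (a * 1) * b
      rearrange = solve-∀
    open TopVertex {p 1 * p 2} p₁p₂*p₁≡n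
    τ-p₂ : τ (p 2) ≡ 2
    τ-p₂ = trans (cong τ (sym (trans (*-identityʳ (p 2 * 1)) (*-identityʳ (p 2))))) (τ-^* p₂ (prime∤1 p₂) 1)
    τ-p₁² : τ (p 1 ^ 2) ≡ 3
    τ-p₁² = trans (cong τ (sym (*-identityʳ (p 1 ^ 2)))) (τ-^* p₁ (prime∤1 p₁) 2)
    deg-p₁p₂≡2 : deg (p 1 * p 2) ≡ 2
    deg-p₁p₂≡2 = suc-injective (suc-injective (begin
      2 + deg (p 1 * p 2) ≡⟨ cong suc (1+deg≡S₁ (≤-reflexive (sym α₁≡2))) ⟩
      suc (S 1)           ≡⟨ suc-properMultiples≡*τ p₁ (p₁≢p₂ ∘ prime∣prime⇒≡ p₁ p₂) 2 n≡p₁²*p₂ ⟩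
      2 * τ (p 2)         ≡⟨ cong (2 *_) τ-p₂ ⟩
      4                   ∎))
      where open ≡-Reasoning
    deg-p₁²≡2 : deg (p 1 ^ 2) ≡ 2
    deg-p₁²≡2 = suc-injective (begin
      suc (deg (p 1 ^ 2)) ≡⟨ cong suc (deg-cofactor-α≡1 1≤2 ≤-refl α₂≡1 (sym n≡p₁²*p₂)) ⟩
      suc (S 2)           ≡⟨ suc-properMultiples≡*τ p₂ p₂∤p₁² 1 n≡p₂*p₁² ⟩
      1 * τ (p 1 ^ 2)     ≡⟨ cong (1 *_) τ-p₁² ⟩
      3                   ∎)
      where
      open ≡-Reasoning
      p₂∤p₁² : ¬ p 2 ∣ p 1 ^ 2
      p₂∤p₁² = prime∤^ p₂ p₁ (p₁≢p₂ ∘ sym) 2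
      n≡p₂*p₁² : n ≡ p 2 ^ 1 * p 1 ^ 2
      n≡p₂*p₁² = trans n≡p₁²*p₂ (trans (*-comm (p 1 ^ 2) (p 2)) (cong (_* p 1 ^ 2) (sym (*-identityʳ (p 2)))))
    to : IsMaxDegree n d → d ≡ p 1 * p 2 ⊎ d ≡ p 1 ^ 2
    to d-max with cofactor⊎deg< (λ ()) (λ ()) (proj₁ d-max)
    ... | inj₂ d<X = contradiction (maxDegree⇒deg≤ d-max) (<⇒≱ d<X)
    ... | inj₁ (1 , _ , _ , d*p₁≡n) = inj₁ (*-cancelʳ-≡ d (p 1 * p 2) (p 1) (trans d*p₁≡n (sym p₁p₂*p₁≡n)))
    ... | inj₁ (2 , _ , _ , d*p₂≡n) = inj₂ (*-cancelʳ-≡ d (p 1 ^ 2) (p 2) (trans d*p₂≡n n≡p₁²*p₂))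
    ... | inj₁ (suc (2+ _) , _ , s≤s (s≤s ()) , _)
    from : d ≡ p 1 * p 2 ⊎ d ≡ p 1 ^ 2 → IsMaxDegree n d
    from (inj₁ refl) = top-max
    from (inj₂ refl) =
      maxDegree-of (cofactor-proper 1≤2 ≤-refl (sym n≡p₁²*p₂)) (≤-reflexive (trans deg-p₁p₂≡2 (sym deg-p₁²≡2)))

proposition2p11 : (n k : ℕ) (p α : ℕ → ℕ) →
    Composite n →
    1 ≤ k →
    (∀ i → 1 ≤ i → i ≤ k → Prime (p i)) →
    (∀ i j → 1 ≤ i → i ≤ k → 1 ≤ j → j ≤ k → i ≢ j → p i ≢ p j) →
    (∀ i → 1 ≤ i → i ≤ k → 1 ≤ α i) →
    (∀ i j → 1 ≤ i → i ≤ j → j ≤ k → α j ≤ α i) →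
    n ≡ prodPow p α k →
    (k ≡ 1 → 3 ≤ α 1) →
    ((k ≡ 1 → α 1 ≡ 3 → IsMaxDegree n (p 1) × IsMaxDegree n (p 1 ^ 2))
    × (k ≡ 2 → α 1 ≡ 2 → α 2 ≡ 1 →
         ∀ d → IsMaxDegree n d ⇔ (d ≡ p 1 * p 2 ⊎ d ≡ p 1 ^ 2))
    × (¬ (k ≡ 1 × α 1 ≡ 3) → ¬ (k ≡ 2 × α 1 ≡ 2 × α 2 ≡ 1) →
         ∀ t → 1 ≤ t → t ≤ k → α t ≡ α 1 → (∀ j → t < j → j ≤ k → α j ≢ α 1) →
         ∀ d → IsMaxDegree n d ⇔ (∃[ i ] (1 ≤ i × i ≤ t × d * p i ≡ n))))
proposition2p11 n k p α n-composite 1≤k primes distinct 1≤α α-antitone n≡prodPow k≡1⇒3≤α₁ =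
  part-i , part-ii , part-iii k≡1⇒3≤α₁
  where open MaxDegree n-composite 1≤k primes distinct 1≤α α-antitone n≡prodPow
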